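{- Let $k\ge 2$, let $\pi$ be a pattern and let $h$ be a non-erasing morphism such that $h(\pi)$ is a factor of $Z_k$. Let $\pi_{(2)}$ be the pattern obtained from $\pi$ by deleting all occurrences of variables whose rank under $h$ is $1$. Then $\pi_{(2)}$ occurs in $Z_{k-1}$, i.e. there is a non-erasing morphism $g$ such that $g(\pi_{(2)})$ is a factor of $Z_{k-1}$.
   Context: Zimin words: $Z_1=1$, $Z_k=Z_{k-1}\,k\,Z_{k-1}$. A pattern is a word over a set of variables; a non-erasing morphism maps each variable to a nonempty word over the positive integers. The rank of a variable $x$ under $h$ is the maximal letter in $h(x)$. By convention the empty pattern occurs in every word. -}

module Defs where

open import Data.Nat using (ℕ; suc; _≡ᵇ_)
open import Data.List using (List; []; _∷_; _++_; concatMap; filter; foldr)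
open import Data.List.Relation.Unary.All using (All)
open import Data.Nat using (_⊔_; _≥_; _≟_)
open import Data.Product using (∃; ∃₂; _×_)
open import Relation.Binary.PropositionalEquality using (_≡_; _≢_)
open import Relation.Nullary using (¬_)
open import Relation.Nullary.Decidable using (¬?)

-- Zimin words: Z 1 = 1, Z (k+1) = Z k (k+1) Z k.  Z 0 = [] (unused).
Z : ℕ → List ℕ
Z 0 = []
Z 1 = 1 ∷ []
Z (suc (suc k)) = Z (suc k) ++ (suc (suc k) ∷ Z (suc k))

Pattern : Set
Pattern = List ℕ

Morphism : Set
Morphism = ℕ → List ℕ

apply : Morphism → Pattern → List ℕ
apply h π = concatMap h π

NonErasing : Morphism → Set
NonErasing h = ∀ x → (h x ≢ []) × All (λ a → a ≥ 1) (h x)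

_IsFactorOf_ : List ℕ → List ℕ → Set
w IsFactorOf z = ∃₂ λ u v → u ++ w ++ v ≡ z

maxLetter : List ℕ → ℕ
maxLetter = foldr _⊔_ 0

rank : Morphism → ℕ → ℕ
rank h x = maxLetter (h x)

deleteRank1 : Morphism → Pattern → Pattern
deleteRank1 h π = filter (λ x → ¬? (rank h x ≟ 1)) π

OccursIn : Pattern → List ℕ → Set
OccursIn π w = ∃ λ g → NonErasing g × (apply g π IsFactorOf w)

module Submission where

-- Let  lower  be the monoid endomorphism of words over ℕ
-- that erases the letters 0 and 1 and decrements every other letter.  Then
-- lower (Z (k+1)) ≡ Z k, so lower maps factors of Z k to factors of Z (k-1).
-- Applying  lower  to  h(π) ⊑ Z k  gives  (lower ∘ h)(π) ⊑ Z (k-1).  A variable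
-- x has rank 1 under h exactly when lower (h x) is empty, so the morphism
-- lower ∘ h erases precisely the rank-1 variables: (lower ∘ h)(π) equals
-- (lower ∘ h)(π₍₂₎), and on the variables of π₍₂₎ it is non-erasing.  Padding
-- the (irrelevant) empty images with the letter 1 yields a non-erasing g with
-- g(π₍₂₎) ⊑ Z (k-1).

open import Defs
open import Data.Nat using (ℕ; zero; suc; _≥_; _≤_; _∸_; _≟_; z≤n; s≤s)
open import Data.Nat.Properties
  using (⊔-lub; m≤m⊔n; m⊔n≤o⇒m≤o; m⊔n≤o⇒n≤o; ≤-trans; ≤-reflexive; ≤-antisym)
open import Data.List using (List; []; _∷_; _++_; concatMap; filter)
open import Data.List.Properties using (concatMap-++)
open import Data.List.Effectful using (module MonadProperties)
open import Data.List.Relation.Unary.All as All using (All; []; _∷_)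
open import Data.List.Relation.Unary.All.Properties using (all-filter)
open import Data.Product using (_,_; _×_; proj₁; proj₂)
open import Function using (_∘_)
open import Relation.Binary.PropositionalEquality
  using (_≡_; _≢_; refl; sym; cong; cong₂; subst; module ≡-Reasoning)
open import Relation.Nullary using (yes; no; ¬_; contradiction)
open import Relation.Nullary.Decidable using (¬?; decidable-stable)
open import Relation.Unary using (Pred; Decidable)

lowerLetter : ℕ → List ℕ
lowerLetter zero          = []
lowerLetter (suc zero)    = []
lowerLetter (suc (suc n)) = suc n ∷ []

lower : List ℕ → List ℕ
lower = concatMap lowerLetter

lower-++ : ∀ u v → lower (u ++ v) ≡ lower u ++ lower v
lower-++ = concatMap-++ lowerLetter

lower-Z : ∀ k → lower (Z (suc (suc k))) ≡ Z (suc k)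
lower-Z zero    = refl
lower-Z (suc k) = begin
  lower (Z (suc (suc k)) ++ suc (suc (suc k)) ∷ Z (suc (suc k)))
    ≡⟨ lower-++ (Z (suc (suc k))) _ ⟩
  lower (Z (suc (suc k))) ++ suc (suc k) ∷ lower (Z (suc (suc k)))
    ≡⟨ cong (λ z → z ++ suc (suc k) ∷ z) (lower-Z k) ⟩
  Z (suc k) ++ suc (suc k) ∷ Z (suc k) ∎
  where open ≡-Reasoning

-- Being a monoid morphism,  lower  preserves the factor relation.
lower-factor : ∀ {w z} → w IsFactorOf z → lower w IsFactorOf lower z
lower-factor {w} (u , v , refl) = lower u , lower v , (begin
  lower u ++ lower w ++ lower v ≡⟨ cong (lower u ++_) (lower-++ w v) ⟨
  lower u ++ lower (w ++ v)     ≡⟨ lower-++ u (w ++ v) ⟨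
  lower (u ++ w ++ v)           ∎)
  where open ≡-Reasoning

lower-positive : ∀ w → All (_≥ 1) (lower w)
lower-positive []                = []
lower-positive (zero ∷ w)        = lower-positive w
lower-positive (suc zero ∷ w)    = lower-positive w
lower-positive (suc (suc n) ∷ w) = s≤s z≤n ∷ lower-positive w

lowerLetter-small : ∀ {a} → a ≤ 1 → lowerLetter a ≡ []
lowerLetter-small z≤n       = refl
lowerLetter-small (s≤s z≤n) = refl

lower-small : ∀ w → maxLetter w ≤ 1 → lower w ≡ []
lower-small []      _ = refl
lower-small (a ∷ w) p =
  cong₂ _++_ (lowerLetter-small (m⊔n≤o⇒m≤o a (maxLetter w) p))
             (lower-small w (m⊔n≤o⇒n≤o a (maxLetter w) p))

lower-empty⇒small : ∀ w → lower w ≡ [] → maxLetter w ≤ 1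
lower-empty⇒small []                _  = z≤n
lower-empty⇒small (zero ∷ w)        e  = ⊔-lub z≤n (lower-empty⇒small w e)
lower-empty⇒small (suc zero ∷ w)    e  = ⊔-lub (s≤s z≤n) (lower-empty⇒small w e)
lower-empty⇒small (suc (suc n) ∷ w) ()

positive-maxLetter : ∀ w → w ≢ [] → All (_≥ 1) w → 1 ≤ maxLetter w
positive-maxLetter []      ne _        = contradiction refl ne
positive-maxLetter (a ∷ w) _  (a≥1 ∷ _) = ≤-trans a≥1 (m≤m⊔n a (maxLetter w))

rank1⇒lower-empty : ∀ h x → rank h x ≡ 1 → lower (h x) ≡ []
rank1⇒lower-empty h x r = lower-small (h x) (≤-reflexive r)

rank≢1⇒lower-nonempty : ∀ h → NonErasing h → ∀ x → rank h x ≢ 1 → lower (h x) ≢ []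
rank≢1⇒lower-nonempty h ne x r≢1 e = r≢1 (≤-antisym
  (lower-empty⇒small (h x) e)
  (positive-maxLetter (h x) (proj₁ (ne x)) (proj₂ (ne x))))

-- Composition of morphisms: lowering the image of π under h is the image of π
-- under the composite morphism; this is associativity of the list monad.
apply-compose : ∀ (φ : ℕ → List ℕ) (h : Morphism) π →
  apply (concatMap φ ∘ h) π ≡ concatMap φ (apply h π)
apply-compose φ h π = MonadProperties.associative π h φ

apply-filter : ∀ {p} {P : Pred ℕ p} (P? : Decidable P) (φ : Morphism) →
  (∀ x → ¬ P x → φ x ≡ []) → ∀ π → apply φ (filter P? π) ≡ apply φ π
apply-filter P? φ erased []      = refl
apply-filter P? φ erased (x ∷ π) with P? x
... | yes _  = cong (φ x ++_) (apply-filter P? φ erased π)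
... | no ¬Px = begin
  apply φ (filter P? π)  ≡⟨ apply-filter P? φ erased π ⟩
  apply φ π              ≡⟨ cong (_++ apply φ π) (erased x ¬Px) ⟨
  φ x ++ apply φ π       ∎
  where open ≡-Reasoning

apply-cong : ∀ (g φ : Morphism) π → All (λ x → g x ≡ φ x) π → apply g π ≡ apply φ π
apply-cong g φ []      []          = refl
apply-cong g φ (x ∷ π) (gx≡φx ∷ a) = cong₂ _++_ gx≡φx (apply-cong g φ π a)

orOne : List ℕ → List ℕ
orOne []      = 1 ∷ []
orOne (a ∷ w) = a ∷ w

orOne-id : ∀ w → w ≢ [] → orOne w ≡ w
orOne-id []      ne = contradiction refl ne
orOne-id (_ ∷ _) _  = refl

orOne-positive : ∀ w → All (_≥ 1) w → (orOne w ≢ []) × All (_≥ 1) (orOne w)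
orOne-positive []      _   = (λ ()) , (s≤s z≤n ∷ [])
orOne-positive (_ ∷ _) pos = (λ ()) , pos

mainTheorem4 : (k : ℕ) → k ≥ 2 → (π : Pattern) → (h : Morphism) →
    NonErasing h → apply h π IsFactorOf Z k →
    OccursIn (deleteRank1 h π) (Z (k ∸ 1))
mainTheorem4 (suc zero) (s≤s ()) _ _ _ _
mainTheorem4 (suc (suc k)) _ π h ne factor =
  g , g-nonErasing , subst (_IsFactorOf Z (suc k)) (sym image) lowered-factor
  where
    g : Morphism
    g x = orOne (lower (h x))

    g-nonErasing : NonErasing g
    g-nonErasing x = orOne-positive (lower (h x)) (lower-positive (h x))

    lowered-factor : lower (apply h π) IsFactorOf Z (suc k)
    lowered-factor = subst (lower (apply h π) IsFactorOf_) (lower-Z k) (lower-factor factor)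

    highRank? : Decidable (λ x → rank h x ≢ 1)
    highRank? x = ¬? (rank h x ≟ 1)

    unpadded : All (λ x → g x ≡ lower (h x)) (deleteRank1 h π)
    unpadded = All.map (λ {x} r≢1 → orOne-id (lower (h x)) (rank≢1⇒lower-nonempty h ne x r≢1))
                       (all-filter highRank? π)

    erased : ∀ x → ¬ (rank h x ≢ 1) → lower (h x) ≡ []
    erased x ¬r≢1 = rank1⇒lower-empty h x (decidable-stable (rank h x ≟ 1) ¬r≢1)

    image : apply g (deleteRank1 h π) ≡ lower (apply h π)
    image = begin
      apply g (deleteRank1 h π)            ≡⟨ apply-cong g (lower ∘ h) _ unpadded ⟩
      apply (lower ∘ h) (deleteRank1 h π)  ≡⟨ apply-filter highRank? (lower ∘ h) erased π ⟩
      apply (lower ∘ h) π                  ≡⟨ apply-compose lowerLetter h π ⟩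
      lower (apply h π)                    ∎
      where open ≡-Reasoning
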